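{- Let $G=(V,E)$ be an undirected graph with nonnegative node weights $w_v\ge 0$ for $v\in V$, and let $\mathcal{C}$ be the (random) set returned by \textsc{NeighborCover} on $G$. Then $\mathcal{C}$ is a vertex cover of $G$ and $$\mathbb{E}\Big[\sum_{v\in\mathcal{C}} w_v\Big]\le 2\cdot \min\Big\{\sum_{v\in S} w_v : S\subseteq V \text{ is a vertex cover of } G\Big\}.$$ That is, \textsc{NeighborCover} is a randomized 2-approximation algorithm for minimum weighted vertex cover.
   Context: A vertex cover of $G$ is a set $S\subseteq V$ such that every edge of $E$ has at least one endpoint in $S$. $N(u)$ denotes the set of neighbors of $u$. The algorithm \textsc{NeighborCover}$(G)$: initialize $\mathcal{C}\leftarrow\emptyset$, $\mathcal{I}\leftarrow\emptyset$, $\mathcal{U}\leftarrow V$ (the set of "undecided" nodes). While $\mathcal{U}\neq\emptyset$: select a node $u\in\mathcal{U}$ at random with probability proportional to its weight, i.e. with probability $w_u/\sum_{x\in\mathcal{U}}w_x$ (independently of previous choices); set $\mathcal{I}\leftarrow\mathcal{I}\cup\{u\}$ and remove $u$ from $\mathcal{U}$; for each $v\in N(u)\cap\mathcal{U}$, add $v$ to $\mathcal{C}$ and remove $v$ from $\mathcal{U}$. When $\mathcal{U}=\emptyset$, return $\mathcal{C}$.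
   Formalization: The node weights $w_v$ are nonnegative rationals. -}

module Defs where

open import Data.Nat.Base as ℕ using (ℕ; zero; suc)
open import Data.Bool.Base using (Bool; true; false; if_then_else_; _∧_; not)
open import Data.Fin.Base using (Fin)
open import Data.Fin.Subset using (Subset; _∈_; ⊥; _∪_; _∩_; _─_; ⁅_⁆)
open import Data.Vec.Base using (tabulate; lookup)
open import Data.List.Base using (List; []; _∷_; map; concatMap; filter; length; foldr)
open import Data.List.Relation.Unary.Any using (Any)
open import Data.Product using (_×_; _,_; proj₁; proj₂)
open import Data.Rational.Base using (ℚ; 0ℚ; 1ℚ; _+_; _*_; _÷_; _/_; ≢-nonZero)
open import Data.Rational.Properties using (_≟_)
open import Data.Integer.Base using (+_)
open import Relation.Nullary using (yes; no; ¬_)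
open import Relation.Binary.PropositionalEquality using (_≡_)
open import Data.Fin.Subset.Properties using (_∈?_)
open import Data.List.Base using () renaming (tabulate to ltabulate)
open import Data.Sum using (_⊎_)
open import Data.Fin.Subset using (⊤)

record Graph (n : ℕ) : Set where
  field
    adj   : Fin n → Fin n → Bool
    sym   : ∀ u v → adj u v ≡ adj v u
    loopless : ∀ v → adj v v ≡ false
open Graph public

Edge : ∀ {n} → Graph n → Fin n → Fin n → Set
Edge G u v = adj G u v ≡ true

IsVertexCover : ∀ {n} → Graph n → Subset n → Set
IsVertexCover G S = ∀ u v → Edge G u v → (u ∈ S) ⊎ (v ∈ S)

N : ∀ {n} → Graph n → Fin n → Subset n
N G u = tabulate (adj G u)

elems : ∀ {n} → Subset n → List (Fin n)
elems {n} S = filter (_∈? S) (ltabulate {n = n} (λ i → i))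

weight : ∀ {n} → (Fin n → ℚ) → Subset n → ℚ
weight w S = foldr (λ v acc → w v + acc) 0ℚ (elems S)

Dist : Set → Set
Dist A = List (ℚ × A)

scale : ∀ {A} → ℚ → Dist A → Dist A
scale p = map (λ { (q , a) → (p * q , a) })

-- Probability of selecting u from the undecided set U:
-- w_u / Σ_{x∈U} w_x; if that total is 0 (all undecided weights are 0, so
-- the distribution is unspecified by the paper), we choose uniformly.
selectProb : ∀ {n} → (Fin n → ℚ) → Subset n → Fin n → ℚ
selectProb w U u with weight w U ≟ 0ℚ
... | no W≢0 = _÷_ (w u) (weight w U) {{≢-nonZero W≢0}}
... | yes _ with length (elems U)
...   | zero  = 0ℚ
...   | suc k = (+ 1) / suc k

-- One step of NeighborCover from state (U , C) after picking u:
-- u goes to I (and leaves U); N(u) ∩ U goes to C and leaves U.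
step : ∀ {n} → Graph n → Subset n → Subset n → Fin n → Subset n × Subset n
step G U C u = ((U ─ ⁅ u ⁆) ─ N G u) , (C ∪ (N G u ∩ U))

-- Output distribution of the while loop from state (U , C), with fuel
-- (each iteration removes at least the chosen node from U, so fuel ≥ |U|
-- suffices; the algorithm is run with fuel n from U = V).
runNC : ∀ {n} → ℕ → Graph n → (Fin n → ℚ) → Subset n → Subset n → Dist (Subset n)
runNC zero G w U C = (1ℚ , C) ∷ []
runNC (suc k) G w U C with elems U
... | [] = (1ℚ , C) ∷ []
... | us@(_ ∷ _) = concatMap
        (λ u → scale (selectProb w U u)
                 (runNC k G w (proj₁ (step G U C u)) (proj₂ (step G U C u))))
        us

neighborCover : ∀ {n} → Graph n → (Fin n → ℚ) → Dist (Subset n)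
neighborCover {n} G w = runNC n G w ⊤ ⊥

expect : ∀ {A} → Dist A → (A → ℚ) → ℚ
expect d f = foldr (λ { (p , a) acc → p * f a + acc }) 0ℚ d

_∈D_ : ∀ {A} → ℚ × A → Dist A → Set
x ∈D d = Any (x ≡_) d

module Submission where

-- Every edge always has an endpoint in C or both endpoints undecided, and a
-- step only removes u and N(u) from the undecided set U while adding
-- N(u) ∩ U to C; when U is exhausted, C is therefore a vertex cover.
--
-- For a vertex cover S consider the potential Φ(U, C) = w(C) + 2 w(S ∩ U).
-- Picking u costs at most w(N(u) ∩ U) and releases the credit
-- 2 w(S ∩ N(u) ∩ U).  Averaged with weights w_u, the cost is the sum of
-- w_u w_v over ordered pairs of adjacent undecided nodes, and each such pair
-- has an endpoint in S, so it is at most the averaged credit.  Hence the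
-- expected potential never increases, and E[w(C)] ≤ Φ(V, ∅) = 2 w(S).
-- (If w(U) = 0 every cost vanishes, whatever the selection rule.)

open import Defs renaming (sym to adj-sym)
open import Data.Bool.Base using (true; false; if_then_else_)
open import Data.Empty using (⊥-elim)
open import Data.Fin.Base using (Fin; zero; suc)
open import Data.Fin.Subset using (Subset; outside; ⁅_⁆; _∈_; _∉_; _⊆_; _∪_; _∩_; _─_; _-_; ⊤; ⊥; ∣_∣)
open import Data.Fin.Subset.Properties
  using (_∈?_; ∈⊤; ∉⊥; p⊆p∪q; q⊆p∪q; x∈p∪q⁻; x∈p∩q⁺; x∈p∩q⁻; p─q⊆p; x∈p∧x∉q⇒x∈p─q;
         x∈p∧x≢y⇒x∈p-y; x∈p⇒p-x⊂p; x∈p⇒∣p-x∣<∣p∣; ⊆-⊂-trans; p⊂q⇒∣p∣<∣q∣;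
         p∩q⊆q; ∣p∣≤n; ∩-identityʳ)
open import Data.List.Membership.Propositional using () renaming (_∈_ to _∈ₗ_)
open import Data.List.Membership.Propositional.Properties using (∈-filter⁺; ∈-filter⁻; ∈-allFin)
open import Data.List.Relation.Unary.All as All using (All; []; _∷_)
open import Data.List.Relation.Unary.All.Properties using (concat⁺; map⁺)
open import Data.List.Base using (List; []; _∷_; foldr; filter; allFin; concatMap; length; _++_)
open import Data.Nat.Base as ℕ using (ℕ; zero; suc)
import Data.Nat.Properties as ℕ
open import Data.Product using (_×_; _,_; proj₁; proj₂)
open import Data.Sum using (_⊎_; inj₁; inj₂; [_,_]′)
open import Data.Integer.Base using (+_)
open import Data.Vec.Base using (lookup; _∷_; here; there)
open import Data.Vec.Properties using (lookup∘tabulate; lookup⇒[]=)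
open import Data.Rational.Base
  using (ℚ; 0ℚ; 1ℚ; _+_; _*_; -_; 1/_; _≤_; *≤*; _<_; _/_; toℚᵘ; nonNegative; positive; ≢-nonZero)
open import Data.Rational.Unnormalised.Base using (mkℚᵘ; *≡*) renaming (_≃_ to _≃ᵘ_)
import Data.Rational.Unnormalised.Properties as ℚᵘ
import Data.Integer.Base as ℤ
import Data.Integer.Properties as ℤ
import Data.Integer.Solver
open import Data.Rational.Properties
open import Data.Rational.Solver using (module +-*-Solver)
open import Function.Base using (_∘_; case_of_)
open import Algebra.Bundles using (CommutativeMonoid)
open import Algebra.Properties.CommutativeSemigroup (CommutativeMonoid.commutativeSemigroup +-0-commutativeMonoid)
  using () renaming (interchange to +-interchange)
open import Relation.Binary.PropositionalEquality
open import Relation.Nullary using (Dec; does; yes; no)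

*-nonneg : ∀ {p q} → 0ℚ ≤ p → 0ℚ ≤ q → 0ℚ ≤ p * q
*-nonneg {p} {q} 0≤p 0≤q =
  nonNegative⁻¹ (p * q) {{nonNeg*nonNeg⇒nonNeg p {{nonNegative 0≤p}} q {{nonNegative 0≤q}}}}

+-cancelʳ-≤ : ∀ p q r → p + r ≤ q + r → p ≤ q
+-cancelʳ-≤ p q r p+r≤q+r = begin
  p             ≡⟨ shift p ⟩
  p + r + - r   ≤⟨ +-monoˡ-≤ (- r) p+r≤q+r ⟩
  q + r + - r   ≡⟨ shift q ⟨
  q             ∎
  where
  open ≤-Reasoning
  shift : ∀ x → x ≡ x + r + - r
  shift x = solve 2 (λ x r → x := x :+ r :+ :- r) refl x r
    where open +-*-Solver

2*p≡p+p : ∀ p → (+ 2 / 1) * p ≡ p + p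
2*p≡p+p = solve 1 (λ p → (con 1ℚ :+ con 1ℚ) :* p := p :+ p) refl
  where open +-*-Solver

module _ {A : Set} where

  listSum : (A → ℚ) → List A → ℚ
  listSum f = foldr (λ x acc → f x + acc) 0ℚ

  listSum-cong : ∀ {f g} xs → (∀ x → f x ≡ g x) → listSum f xs ≡ listSum g xs
  listSum-cong []       f≗g = refl
  listSum-cong (x ∷ xs) f≗g = cong₂ _+_ (f≗g x) (listSum-cong xs f≗g)

  listSum-mono-≤ : ∀ {f g} xs → (∀ x → f x ≤ g x) → listSum f xs ≤ listSum g xs
  listSum-mono-≤ []       f≤g = ≤-refl
  listSum-mono-≤ (x ∷ xs) f≤g = +-mono-≤ (f≤g x) (listSum-mono-≤ xs f≤g)

  listSum-nonneg : ∀ {f} xs → (∀ x → 0ℚ ≤ f x) → 0ℚ ≤ listSum f xs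
  listSum-nonneg []       0≤f = ≤-refl
  listSum-nonneg (x ∷ xs) 0≤f = +-mono-≤ (0≤f x) (listSum-nonneg xs 0≤f)

  listSum-distrib-+ : ∀ f g xs → listSum (λ x → f x + g x) xs ≡ listSum f xs + listSum g xs
  listSum-distrib-+ f g []       = refl
  listSum-distrib-+ f g (x ∷ xs) = begin
    (f x + g x) + listSum (λ x → f x + g x) xs   ≡⟨ cong (_+_ (f x + g x)) (listSum-distrib-+ f g xs) ⟩
    (f x + g x) + (listSum f xs + listSum g xs)  ≡⟨ +-interchange (f x) (g x) (listSum f xs) (listSum g xs) ⟩
    (f x + listSum f xs) + (g x + listSum g xs)  ∎
    where open ≡-Reasoning

  listSum-*ˡ : ∀ c f xs → listSum (λ x → c * f x) xs ≡ c * listSum f xs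
  listSum-*ˡ c f []       = sym (*-zeroʳ c)
  listSum-*ˡ c f (x ∷ xs) =
    trans (cong (_+_ (c * f x)) (listSum-*ˡ c f xs)) (sym (*-distribˡ-+ c (f x) (listSum f xs)))

  listSum-filter : ∀ {P : A → Set} (P? : ∀ x → Dec (P x)) f xs →
    listSum f (filter P? xs) ≡ listSum (λ x → if does (P? x) then f x else 0ℚ) xs
  listSum-filter P? f []       = refl
  listSum-filter P? f (x ∷ xs) with does (P? x)
  ... | true  = cong (_+_ (f x)) (listSum-filter P? f xs)
  ... | false = trans (listSum-filter P? f xs) (sym (+-identityˡ _))

  listSum-zero : ∀ xs → listSum (λ _ → 0ℚ) xs ≡ 0ℚ
  listSum-zero []       = refl
  listSum-zero (x ∷ xs) = trans (+-identityˡ _) (listSum-zero xs)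

listSum-comm : ∀ {A B : Set} (f : A → B → ℚ) xs ys →
  listSum (λ x → listSum (f x) ys) xs ≡ listSum (λ y → listSum (λ x → f x y) xs) ys
listSum-comm f []       ys = sym (listSum-zero ys)
listSum-comm f (x ∷ xs) ys =
  trans (cong (_+_ (listSum (f x) ys)) (listSum-comm f xs ys))
        (sym (listSum-distrib-+ (f x) (λ y → listSum (λ x → f x y) xs) ys))

-- ℚ addition normalises its result, so the uniform sum is evaluated in ℚᵘ.
listSum-const-≃ : ∀ {A : Set} m (xs : List A) →
  toℚᵘ (listSum (λ _ → + 1 / suc m) xs) ≃ᵘ mkℚᵘ (+ length xs) m
listSum-const-≃ m []       = *≡* refl
listSum-const-≃ m (x ∷ xs) =
  ℚᵘ.≃-trans (toℚᵘ-homo-+ (+ 1 / suc m) _)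
    (ℚᵘ.≃-trans (ℚᵘ.+-cong (toℚᵘ-fromℚᵘ (mkℚᵘ (+ 1) m)) (listSum-const-≃ m xs)) (*≡* add-numerators))
  where
  open Data.Integer.Solver.+-*-Solver
  s = + suc m
  add-numerators : (+ 1 ℤ.* s ℤ.+ + length xs ℤ.* s) ℤ.* s ≡ (+ 1 ℤ.+ + length xs) ℤ.* + (suc m ℕ.* suc m)
  add-numerators = trans (solve 2 (λ s k → (con (+ 1) :* s :+ k :* s) :* s := (con (+ 1) :+ k) :* (s :* s)) refl s (+ length xs))
                         (cong ((+ 1 ℤ.+ + length xs) ℤ.*_) (sym (ℤ.pos-* (suc m) (suc m))))

listSum-uniform : ∀ {A : Set} (x : A) xs → listSum (λ _ → + 1 / suc (length xs)) (x ∷ xs) ≡ 1ℚ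
listSum-uniform x xs = toℚᵘ-injective
  (ℚᵘ.≃-trans (listSum-const-≃ (length xs) (x ∷ xs)) (*≡* (ℤ.*-comm (+ suc (length xs)) (+ 1))))

∑ : ∀ {n} → (Fin n → ℚ) → ℚ
∑ {n} f = listSum f (allFin n)

infixl 8 _↾_
_↾_ : ∀ {n} → (Fin n → ℚ) → Subset n → Fin n → ℚ
(f ↾ V) i = if does (i ∈? V) then f i else 0ℚ

does-∈? : ∀ {n} (i : Fin n) p → does (i ∈? p) ≡ lookup p i
does-∈? zero    (true  ∷ p) = refl
does-∈? zero    (false ∷ p) = refl
does-∈? (suc i) (_     ∷ p) = does-∈? i p

x∈p─q⇒x∉q : ∀ {n} {p q : Subset n} {x} → x ∈ p ─ q → x ∉ q
x∈p─q⇒x∉q {p = _ ∷ p} {outside ∷ q} here          ()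
x∈p─q⇒x∉q {p = _ ∷ p} {_       ∷ q} (there x∈p─q) (there x∈q) = x∈p─q⇒x∉q x∈p─q x∈q

∈-elems⁻ : ∀ {n} {U : Subset n} {u} → u ∈ₗ elems U → u ∈ U
∈-elems⁻ {n} {U} u∈ = proj₂ (∈-filter⁻ (_∈? U) {xs = allFin n} u∈)

elems≡[]⇒∉ : ∀ {n} {U : Subset n} → elems U ≡ [] → ∀ i → i ∉ U
elems≡[]⇒∉ {U = U} elems≡[] i i∈U with subst (i ∈ₗ_) elems≡[] (∈-filter⁺ (_∈? U) (∈-allFin i) i∈U)
... | ()

∣p∣≤0⇒∉ : ∀ {n} {U : Subset n} → ∣ U ∣ ℕ.≤ 0 → ∀ i → i ∉ U
∣p∣≤0⇒∉ ∣U∣≤0 i i∈U = ℕ.n≮0 (ℕ.<-≤-trans (x∈p⇒∣p-x∣<∣p∣ i∈U) ∣U∣≤0)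

weight≡∑ : ∀ {n} (w : Fin n → ℚ) V → weight w V ≡ ∑ (w ↾ V)
weight≡∑ {n} w V = listSum-filter (_∈? V) w (allFin n)

module _ {n} {f : Fin n → ℚ} where

  ↾-⊥ : ∀ i → (f ↾ ⊥) i ≡ 0ℚ
  ↾-⊥ i with i ∈? ⊥
  ... | yes i∈⊥ = ⊥-elim (∉⊥ i∈⊥)
  ... | no  _   = refl

  ↾-∈ : ∀ {A i} → i ∈ A → (f ↾ A) i ≡ f i
  ↾-∈ {A} {i} i∈A with i ∈? A
  ... | yes _   = refl
  ... | no  i∉A = ⊥-elim (i∉A i∈A)

  ↾-∩ : ∀ A B i → (f ↾ (A ∩ B)) i ≡ ((f ↾ B) ↾ A) i
  ↾-∩ A B i with i ∈? A | i ∈? B | i ∈? A ∩ B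
  ... | yes _   | yes _   | yes _     = refl
  ... | yes i∈A | yes i∈B | no  i∉A∩B = ⊥-elim (i∉A∩B (x∈p∩q⁺ (i∈A , i∈B)))
  ... | yes _   | no  i∉B | yes i∈A∩B = ⊥-elim (i∉B (proj₂ (x∈p∩q⁻ A B i∈A∩B)))
  ... | no  i∉A | _       | yes i∈A∩B = ⊥-elim (i∉A (proj₁ (x∈p∩q⁻ A B i∈A∩B)))
  ... | yes _   | no  _   | no  _     = refl
  ... | no  _   | _       | no  _     = refl

  ↾-cong : ∀ {g} A → (∀ i → f i ≡ g i) → ∀ i → (f ↾ A) i ≡ (g ↾ A) i
  ↾-cong A f≗g i = cong (λ x → if does (i ∈? A) then x else 0ℚ) (f≗g i)

  ↾-*ʳ : ∀ (g : Fin n → ℚ) A i → ((λ j → f j * g j) ↾ A) i ≡ (f ↾ A) i * g i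
  ↾-*ʳ g A i with does (i ∈? A)
  ... | true  = refl
  ... | false = sym (*-zeroˡ (g i))

  ↾-*ˡ : ∀ c A i → c * (f ↾ A) i ≡ ((λ j → c * f j) ↾ A) i
  ↾-*ˡ c A i with does (i ∈? A)
  ... | true  = refl
  ... | false = *-zeroʳ c

  module _ (f≥0 : ∀ i → 0ℚ ≤ f i) where

    ↾-nonneg : ∀ A i → 0ℚ ≤ (f ↾ A) i
    ↾-nonneg A i with does (i ∈? A)
    ... | true  = f≥0 i
    ... | false = ≤-refl

    ↾-∪ : ∀ A B i → (f ↾ (A ∪ B)) i ≤ (f ↾ A) i + (f ↾ B) i
    ↾-∪ A B i with i ∈? A ∪ B
    ... | no  _       = +-mono-≤ (↾-nonneg A i) (↾-nonneg B i)
    ... | yes i∈A∪B with x∈p∪q⁻ A B i∈A∪B | i ∈? A | i ∈? B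
    ...   | _        | yes _ | yes _ = ≤-trans (≤-reflexive (sym (+-identityʳ (f i)))) (+-monoʳ-≤ (f i) (f≥0 i))
    ...   | _        | yes _ | no  _ = ≤-reflexive (sym (+-identityʳ (f i)))
    ...   | _        | no  _ | yes _ = ≤-reflexive (sym (+-identityˡ (f i)))
    ...   | inj₁ i∈A | no i∉A | no _  = ⊥-elim (i∉A i∈A)
    ...   | inj₂ i∈B | no _  | no i∉B = ⊥-elim (i∉B i∈B)

    ↾-mono : ∀ {A B} → A ⊆ B → ∀ i → (f ↾ A) i ≤ (f ↾ B) i
    ↾-mono {A} {B} A⊆B i with i ∈? A
    ... | no  _   = ↾-nonneg B i
    ... | yes i∈A = ≤-reflexive (sym (↾-∈ (A⊆B i∈A)))

    ↾-disjoint : ∀ {A B C} → A ⊆ C → B ⊆ C → (∀ {i} → i ∈ A → i ∉ B) →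
      ∀ i → (f ↾ A) i + (f ↾ B) i ≤ (f ↾ C) i
    ↾-disjoint {A} {B} {C} A⊆C B⊆C A∩B≡∅ i with i ∈? A
    ... | no  _   = ≤-trans (≤-reflexive (+-identityˡ _)) (↾-mono B⊆C i)
    ... | yes i∈A with i ∈? B
    ...   | yes i∈B = ⊥-elim (A∩B≡∅ i∈A i∈B)
    ...   | no  _   = ≤-reflexive (trans (+-identityʳ (f i)) (sym (↾-∈ (A⊆C i∈A))))

module _ {n} (w : Fin n → ℚ) where

  weight-⊥ : weight w ⊥ ≡ 0ℚ
  weight-⊥ = trans (weight≡∑ w ⊥) (trans (listSum-cong (allFin n) ↾-⊥) (listSum-zero (allFin n)))

  module _ (w≥0 : ∀ i → 0ℚ ≤ w i) where

    weight-nonneg : ∀ V → 0ℚ ≤ weight w V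
    weight-nonneg V = listSum-nonneg (elems V) w≥0

    weight-∪ : ∀ A B → weight w (A ∪ B) ≤ weight w A + weight w B
    weight-∪ A B = begin
      weight w (A ∪ B)                 ≡⟨ weight≡∑ w (A ∪ B) ⟩
      ∑ (w ↾ (A ∪ B))                  ≤⟨ listSum-mono-≤ (allFin n) (↾-∪ w≥0 A B) ⟩
      ∑ (λ i → (w ↾ A) i + (w ↾ B) i)  ≡⟨ listSum-distrib-+ (w ↾ A) (w ↾ B) (allFin n) ⟩
      ∑ (w ↾ A) + ∑ (w ↾ B)            ≡⟨ cong₂ _+_ (weight≡∑ w A) (weight≡∑ w B) ⟨
      weight w A + weight w B          ∎
      where open ≤-Reasoning

    weight-mono : ∀ {A B} → A ⊆ B → weight w A ≤ weight w B
    weight-mono {A} {B} A⊆B = begin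
      weight w A  ≡⟨ weight≡∑ w A ⟩
      ∑ (w ↾ A)   ≤⟨ listSum-mono-≤ (allFin n) (↾-mono w≥0 A⊆B) ⟩
      ∑ (w ↾ B)   ≡⟨ weight≡∑ w B ⟨
      weight w B  ∎
      where open ≤-Reasoning

    weight-disjoint : ∀ {A B C} → A ⊆ C → B ⊆ C → (∀ {i} → i ∈ A → i ∉ B) →
      weight w A + weight w B ≤ weight w C
    weight-disjoint {A} {B} {C} A⊆C B⊆C A∩B≡∅ = begin
      weight w A + weight w B          ≡⟨ cong₂ _+_ (weight≡∑ w A) (weight≡∑ w B) ⟩
      ∑ (w ↾ A) + ∑ (w ↾ B)            ≡⟨ listSum-distrib-+ (w ↾ A) (w ↾ B) (allFin n) ⟨
      ∑ (λ i → (w ↾ A) i + (w ↾ B) i)  ≤⟨ listSum-mono-≤ (allFin n) (↾-disjoint w≥0 A⊆C B⊆C A∩B≡∅) ⟩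
      ∑ (w ↾ C)                        ≡⟨ weight≡∑ w C ⟨
      weight w C                       ∎
      where open ≤-Reasoning

module _ {A : Set} where

  expect-++ : ∀ (d₁ d₂ : Dist A) f → expect (d₁ ++ d₂) f ≡ expect d₁ f + expect d₂ f
  expect-++ []             d₂ f = sym (+-identityˡ _)
  expect-++ ((p , a) ∷ d₁) d₂ f =
    trans (cong (_+_ (p * f a)) (expect-++ d₁ d₂ f)) (sym (+-assoc (p * f a) _ _))

  expect-scale : ∀ q (d : Dist A) f → expect (scale q d) f ≡ q * expect d f
  expect-scale q []            f = sym (*-zeroʳ q)
  expect-scale q ((p , a) ∷ d) f = begin
    q * p * f a + expect (scale q d) f  ≡⟨ cong₂ _+_ (*-assoc q p (f a)) (expect-scale q d f) ⟩
    q * (p * f a) + q * expect d f      ≡⟨ *-distribˡ-+ q (p * f a) (expect d f) ⟨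
    q * (p * f a + expect d f)          ∎
    where open ≡-Reasoning

  expect-concatMap : ∀ {B : Set} (F : B → Dist A) us f →
    expect (concatMap F us) f ≡ listSum (λ u → expect (F u) f) us
  expect-concatMap F []       f = refl
  expect-concatMap F (u ∷ us) f =
    trans (expect-++ (F u) (concatMap F us) f) (cong (_+_ (expect (F u) f)) (expect-concatMap F us f))

average-≤ : ∀ {A : Set} (us : List A) {p f g h : A → ℚ} {c} →
  (∀ u → 0ℚ ≤ p u) → listSum p us ≡ 1ℚ → (∀ u → f u + h u ≤ c + g u) →
  listSum (λ u → p u * g u) us ≤ listSum (λ u → p u * h u) us →
  listSum (λ u → p u * f u) us ≤ c
average-≤ us {p} {f} {g} {h} {c} p≥0 ∑p≡1 f+h≤c+g ∑pg≤∑ph = +-cancelʳ-≤ _ c (𝔼[ h ]) (begin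
  𝔼[ f ] + 𝔼[ h ]                                 ≡⟨ listSum-distrib-+ (λ u → p u * f u) (λ u → p u * h u) us ⟨
  listSum (λ u → p u * f u + p u * h u) us        ≡⟨ listSum-cong us (λ u → *-distribˡ-+ (p u) (f u) (h u)) ⟨
  listSum (λ u → p u * (f u + h u)) us            ≤⟨ listSum-mono-≤ us (λ u →
                                                       *-monoˡ-≤-nonNeg (p u) {{nonNegative (p≥0 u)}} (f+h≤c+g u)) ⟩
  listSum (λ u → p u * (c + g u)) us              ≡⟨ listSum-cong us (λ u → distrib (p u) (g u)) ⟩
  listSum (λ u → c * p u + p u * g u) us          ≡⟨ listSum-distrib-+ (λ u → c * p u) (λ u → p u * g u) us ⟩
  listSum (λ u → c * p u) us + 𝔼[ g ]             ≡⟨ cong (_+ 𝔼[ g ]) (trans (listSum-*ˡ c p us) (cong (c *_) ∑p≡1)) ⟩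
  c * 1ℚ + 𝔼[ g ]                                 ≤⟨ +-mono-≤ (≤-reflexive (*-identityʳ c)) ∑pg≤∑ph ⟩
  c + 𝔼[ h ]                                      ∎)
  where
  open ≤-Reasoning
  𝔼[_] : _ → ℚ
  𝔼[ k ] = listSum (λ u → p u * k u) us
  distrib : ∀ x y → x * (c + y) ≡ c * x + x * y
  distrib x y = solve 3 (λ x c y → x :* (c :+ y) := c :* x :+ x :* y) refl x c y
    where open +-*-Solver

module _ {n} (G : Graph n) where

  ↾-N : ∀ (f : Fin n → ℚ) u v → (f ↾ N G u) v ≡ (if adj G u v then f v else 0ℚ)
  ↾-N f u v = cong (λ b → if b then f v else 0ℚ) (trans (does-∈? v (N G u)) (lookup∘tabulate (adj G u) v))

  Edge⇒∈N : ∀ {u v} → Edge G u v → v ∈ N G u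
  Edge⇒∈N {u} {v} e = lookup⇒[]= v (N G u) (trans (lookup∘tabulate (adj G u) v) e)

  module _ {S : Subset n} (S-cover : IsVertexCover G S) (a : Fin n → Fin n → ℚ)
           (a≥0 : ∀ u v → 0ℚ ≤ a u v) (a-sym : ∀ u v → a u v ≡ a v u)
           (a-nonedge : ∀ u v → adj G u v ≡ false → a u v ≡ 0ℚ) where

    ∑∑-≤-2*∑∑-cover : ∑ (λ u → ∑ (a u)) ≤ (+ 2 / 1) * ∑ (λ u → ∑ (a u ↾ S))
    ∑∑-≤-2*∑∑-cover = begin
      ∑ (λ u → ∑ (a u))
        ≤⟨ listSum-mono-≤ (allFin n) (λ u → listSum-mono-≤ (allFin n) (split u)) ⟩
      ∑ (λ u → ∑ (λ v → (a u ↾ S) v + (a v ↾ S) u))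
        ≡⟨ listSum-cong (allFin n) (λ u → listSum-distrib-+ (a u ↾ S) (λ v → (a v ↾ S) u) (allFin n)) ⟩
      ∑ (λ u → ∑ (a u ↾ S) + ∑ (λ v → (a v ↾ S) u))
        ≡⟨ listSum-distrib-+ (λ u → ∑ (a u ↾ S)) (λ u → ∑ (λ v → (a v ↾ S) u)) (allFin n) ⟩
      X + ∑ (λ u → ∑ (λ v → (a v ↾ S) u))
        ≡⟨ cong (_+_ X) (listSum-comm (λ u v → (a v ↾ S) u) (allFin n) (allFin n)) ⟩
      X + X
        ≡⟨ 2*p≡p+p X ⟨
      (+ 2 / 1) * X
        ∎
      where
      open ≤-Reasoning
      X = ∑ (λ u → ∑ (a u ↾ S))
      -- a u v is charged to an endpoint in S; summing, the swap u ↔ v turns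
      -- the second charge into the first.
      split : ∀ u v → a u v ≤ (a u ↾ S) v + (a v ↾ S) u
      split u v with v ∈? S
      ... | yes _ = ≤-trans (≤-reflexive (sym (+-identityʳ (a u v)))) (+-monoʳ-≤ (a u v) (↾-nonneg (a≥0 v) S u))
      ... | no v∉S with u ∈? S
      ...   | yes _ = ≤-reflexive (trans (a-sym u v) (sym (+-identityˡ (a v u))))
      ...   | no u∉S with adj G u v in uv
      ...     | true  = ⊥-elim ([ u∉S , v∉S ]′ (S-cover u v uv))
      ...     | false = ≤-reflexive (trans (a-nonedge u v uv) (sym (+-identityˡ 0ℚ)))

  CoveredOrUndecided : Subset n → Subset n → Set
  CoveredOrUndecided U C = ∀ u v → Edge G u v → u ∈ C ⊎ v ∈ C ⊎ (u ∈ U × v ∈ U)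

  step-covered : ∀ {U C} u → CoveredOrUndecided U C →
    CoveredOrUndecided ((U - u) ─ N G u) (C ∪ (N G u ∩ U))
  step-covered {U} {C} u inv a b ab with inv a b ab
  ... | inj₁ a∈C        = inj₁ (p⊆p∪q (N G u ∩ U) a∈C)
  ... | inj₂ (inj₁ b∈C) = inj₂ (inj₁ (p⊆p∪q (N G u ∩ U) b∈C))
  ... | inj₂ (inj₂ (a∈U , b∈U)) with a ∈? N G u | b ∈? N G u
  ...   | yes a∈Nu | _        = inj₁ (q⊆p∪q C (N G u ∩ U) (x∈p∩q⁺ (a∈Nu , a∈U)))
  ...   | no  _    | yes b∈Nu = inj₂ (inj₁ (q⊆p∪q C (N G u ∩ U) (x∈p∩q⁺ (b∈Nu , b∈U))))
  ...   | no  a∉Nu | no  b∉Nu = inj₂ (inj₂ (remains a∈U a≢u a∉Nu , remains b∈U b≢u b∉Nu))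
    where
    remains : ∀ {x} → x ∈ U → x ≢ u → x ∉ N G u → x ∈ (U - u) ─ N G u
    remains x∈U x≢u x∉Nu = x∈p∧x∉q⇒x∈p─q (x∈p∧x≢y⇒x∈p-y x∈U x≢u) x∉Nu
    a≢u : a ≢ u
    a≢u refl = b∉Nu (Edge⇒∈N ab)
    b≢u : b ≢ u
    b≢u refl = a∉Nu (Edge⇒∈N (trans (adj-sym G u a) ab))

  covered⇒cover : ∀ {U C} → (∀ i → i ∉ U) → CoveredOrUndecided U C → IsVertexCover G C
  covered⇒cover U≡∅ inv u v uv with inv u v uv
  ... | inj₁ u∈C               = inj₁ u∈C
  ... | inj₂ (inj₁ v∈C)        = inj₂ v∈C
  ... | inj₂ (inj₂ (u∈U , _))  = ⊥-elim (U≡∅ u u∈U)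

module _ {n} (G : Graph n) (w : Fin n → ℚ) where

  runNC-covers : ∀ k U C → ∣ U ∣ ℕ.≤ k → CoveredOrUndecided G U C →
    All (IsVertexCover G ∘ proj₂) (runNC k G w U C)
  runNC-covers zero    U C ∣U∣≤0 inv = covered⇒cover G (∣p∣≤0⇒∉ ∣U∣≤0) inv ∷ []
  runNC-covers (suc k) U C ∣U∣≤1+k inv with elems U in elems≡
  ... | []     = covered⇒cover G (elems≡[]⇒∉ elems≡) inv ∷ []
  ... | _ ∷ _  = concat⁺ (map⁺ (All.tabulate λ u∈ → map⁺ (recurse (∈-elems⁻ (subst (_ ∈ₗ_) (sym elems≡) u∈)))))
    where
    recurse : ∀ {u} → u ∈ U → All (IsVertexCover G ∘ proj₂) (runNC k G w ((U - u) ─ N G u) (C ∪ (N G u ∩ U)))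
    recurse {u} u∈U = runNC-covers k _ _ (ℕ.≤-pred (ℕ.≤-trans shrinks ∣U∣≤1+k)) (step-covered G u inv)
      where
      shrinks : ∣ (U - u) ─ N G u ∣ ℕ.< ∣ U ∣
      shrinks = p⊂q⇒∣p∣<∣q∣ (⊆-⊂-trans (p─q⊆p (U - u) (N G u)) (x∈p⇒p-x⊂p u∈U))

module _ {n} (w : Fin n → ℚ) (w≥0 : ∀ i → 0ℚ ≤ w i) (U : Subset n) where

  private
    W = weight w U

  selectProb-proportional : (W≢0 : W ≢ 0ℚ) → ∀ u →
    selectProb w U u ≡ w u * (1/ W) {{≢-nonZero W≢0}}
  selectProb-proportional W≢0 u with weight w U ≟ 0ℚ
  ... | yes W≡0 = ⊥-elim (W≢0 W≡0)
  ... | no  _   = refl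

  selectProb-uniform : ∀ {x xs} → elems U ≡ x ∷ xs → W ≡ 0ℚ → ∀ u →
    selectProb w U u ≡ + 1 / suc (length xs)
  selectProb-uniform elems≡ W≡0 u with weight w U ≟ 0ℚ
  ... | no W≢0 = ⊥-elim (W≢0 W≡0)
  ... | yes _ with length (elems U) | cong length elems≡
  ...   | _ | refl = refl

  private
    1/W≥0 : (W≢0 : W ≢ 0ℚ) → 0ℚ ≤ (1/ W) {{≢-nonZero W≢0}}
    1/W≥0 W≢0 = <⇒≤ (positive⁻¹ _ {{1/pos⇒pos W {{positive W>0}}}})
      where
      W>0 : 0ℚ < W
      W>0 = ≰⇒> (λ W≤0 → W≢0 (≤-antisym W≤0 (weight-nonneg w w≥0 U)))

  selectProb-nonneg : ∀ u → 0ℚ ≤ selectProb w U u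
  selectProb-nonneg u with weight w U ≟ 0ℚ
  ... | no  W≢0 = *-nonneg (w≥0 u) (1/W≥0 W≢0)
  ... | yes _ with length (elems U)
  ...   | zero  = ≤-refl
  ...   | suc k = nonNegative⁻¹ _ {{normalize-nonNeg 1 (suc k)}}

  selectProb-sum : ∀ {x xs} → elems U ≡ x ∷ xs → listSum (selectProb w U) (elems U) ≡ 1ℚ
  selectProb-sum {x} {xs} elems≡ = case W ≟ 0ℚ of λ where
      (yes W≡0) → begin
        listSum (selectProb w U) (elems U)               ≡⟨ listSum-cong (elems U) (selectProb-uniform elems≡ W≡0) ⟩
        listSum (λ _ → + 1 / suc (length xs)) (elems U)  ≡⟨ cong (listSum (λ _ → + 1 / suc (length xs))) elems≡ ⟩
        listSum (λ _ → + 1 / suc (length xs)) (x ∷ xs)   ≡⟨ listSum-uniform x xs ⟩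
        1ℚ                                               ∎
      (no W≢0) → let instance _ = ≢-nonZero W≢0 in begin
        listSum (selectProb w U) (elems U)    ≡⟨ listSum-cong (elems U) (λ u →
                                                   trans (selectProb-proportional W≢0 u) (*-comm (w u) (1/ W))) ⟩
        listSum (λ u → 1/ W * w u) (elems U)  ≡⟨ listSum-*ˡ (1/ W) w (elems U) ⟩
        1/ W * W                              ≡⟨ *-inverseˡ W ⟩
        1ℚ                                    ∎
    where open ≡-Reasoning

  selectProb-mono : ∀ {g h : Fin n → ℚ} → (W ≡ 0ℚ → ∀ u → g u ≤ h u) →
    listSum (λ u → w u * g u) (elems U) ≤ listSum (λ u → w u * h u) (elems U) →
    listSum (λ u → selectProb w U u * g u) (elems U) ≤ listSum (λ u → selectProb w U u * h u) (elems U)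
  selectProb-mono {g} {h} g≤h ∑wg≤∑wh = case W ≟ 0ℚ of λ where
      (yes W≡0) → listSum-mono-≤ (elems U) (λ u →
        *-monoˡ-≤-nonNeg (selectProb w U u) {{nonNegative (selectProb-nonneg u)}} (g≤h W≡0 u))
      (no W≢0) → let instance _ = ≢-nonZero W≢0 in begin
        listSum (λ u → selectProb w U u * g u) (elems U)  ≡⟨ rescale W≢0 g ⟩
        1/ W * listSum (λ u → w u * g u) (elems U)         ≤⟨ *-monoˡ-≤-nonNeg (1/ W) {{nonNegative (1/W≥0 W≢0)}} ∑wg≤∑wh ⟩
        1/ W * listSum (λ u → w u * h u) (elems U)         ≡⟨ rescale W≢0 h ⟨
        listSum (λ u → selectProb w U u * h u) (elems U)  ∎
    where
    open ≤-Reasoning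
    rescale : (W≢0 : W ≢ 0ℚ) → ∀ k → listSum (λ u → selectProb w U u * k u) (elems U)
      ≡ (1/ W) {{≢-nonZero W≢0}} * listSum (λ u → w u * k u) (elems U)
    rescale W≢0 k = let instance _ = ≢-nonZero W≢0 in trans
      (listSum-cong (elems U) (λ u → trans (cong (_* k u) (selectProb-proportional W≢0 u))
                                             (reassoc (w u) (1/ W) (k u))))
      (listSum-*ˡ (1/ W) (λ u → w u * k u) (elems U))
      where
      reassoc : ∀ x y z → x * y * z ≡ y * (x * z)
      reassoc = solve 3 (λ x y z → x :* y :* z := y :* (x :* z)) refl
        where open +-*-Solver

module _ {n} (G : Graph n) (w : Fin n → ℚ) (w≥0 : ∀ i → 0ℚ ≤ w i)
         {S : Subset n} (S-cover : IsVertexCover G S) where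

  private
    two : ℚ
    two = + 2 / 1

    0≤2 : 0ℚ ≤ two
    0≤2 = *≤* (ℤ.+≤+ ℕ.z≤n)

  potential : Subset n → Subset n → ℚ
  potential U C = weight w C + two * weight w (S ∩ U)

  cost credit : Subset n → Fin n → ℚ
  cost   U u = weight w (N G u ∩ U)
  credit U u = two * weight w (S ∩ (N G u ∩ U))

  potential-step : ∀ U C u →
    potential ((U - u) ─ N G u) (C ∪ (N G u ∩ U)) + credit U u ≤ potential U C + cost U u
  potential-step U C u = begin
    weight w C′ + two * weight w (S ∩ U′) + two * weight w (S ∩ (N G u ∩ U))
      ≡⟨ regroup (weight w C′) (weight w (S ∩ U′)) (weight w (S ∩ (N G u ∩ U))) ⟩
    weight w C′ + two * (weight w (S ∩ U′) + weight w (S ∩ (N G u ∩ U)))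
      ≤⟨ +-mono-≤ (weight-∪ w w≥0 C (N G u ∩ U))
                  (*-monoˡ-≤-nonNeg two {{nonNegative 0≤2}} (weight-disjoint w w≥0 SU′⊆SU SNU⊆SU SU′∩SNU≡∅)) ⟩
    weight w C + cost U u + two * weight w (S ∩ U)
      ≡⟨ regroup′ (weight w C) (cost U u) (weight w (S ∩ U)) ⟩
    weight w C + two * weight w (S ∩ U) + cost U u
      ∎
    where
    open ≤-Reasoning
    open +-*-Solver
    U′ = (U - u) ─ N G u
    C′ = C ∪ (N G u ∩ U)
    regroup : ∀ a b c → a + two * b + two * c ≡ a + two * (b + c)
    regroup = solve 3 (λ a b c → a :+ con two :* b :+ con two :* c := a :+ con two :* (b :+ c)) refl
    regroup′ : ∀ a b c → a + b + two * c ≡ a + two * c + b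
    regroup′ = solve 3 (λ a b c → a :+ b :+ con two :* c := a :+ con two :* c :+ b) refl
    SU′⊆SU : S ∩ U′ ⊆ S ∩ U
    SU′⊆SU i∈SU′ with x∈p∩q⁻ S U′ i∈SU′
    ... | i∈S , i∈U′ = x∈p∩q⁺ (i∈S , p─q⊆p U ⁅ u ⁆ (p─q⊆p (U - u) (N G u) i∈U′))
    SNU⊆SU : S ∩ (N G u ∩ U) ⊆ S ∩ U
    SNU⊆SU i∈SNU with x∈p∩q⁻ S (N G u ∩ U) i∈SNU
    ... | i∈S , i∈NU = x∈p∩q⁺ (i∈S , p∩q⊆q (N G u) U i∈NU)
    SU′∩SNU≡∅ : ∀ {i} → i ∈ S ∩ U′ → i ∉ S ∩ (N G u ∩ U)
    SU′∩SNU≡∅ i∈SU′ i∈SNU = x∈p─q⇒x∉q (proj₂ (x∈p∩q⁻ S U′ i∈SU′))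
      (proj₁ (x∈p∩q⁻ (N G u) U (proj₂ (x∈p∩q⁻ S (N G u ∩ U) i∈SNU))))

  pairWeight : Subset n → Fin n → Fin n → ℚ
  pairWeight U u v = if adj G u v then (w ↾ U) u * (w ↾ U) v else 0ℚ

  pairWeight-nonneg : ∀ U u v → 0ℚ ≤ pairWeight U u v
  pairWeight-nonneg U u v with adj G u v
  ... | true  = *-nonneg (↾-nonneg w≥0 U u) (↾-nonneg w≥0 U v)
  ... | false = ≤-refl

  pairWeight-sym : ∀ U u v → pairWeight U u v ≡ pairWeight U v u
  pairWeight-sym U u v rewrite adj-sym G u v with adj G v u
  ... | true  = *-comm ((w ↾ U) u) ((w ↾ U) v)
  ... | false = refl

  pairWeight-nonedge : ∀ U u v → adj G u v ≡ false → pairWeight U u v ≡ 0ℚ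
  pairWeight-nonedge U u v uv rewrite uv = refl

  ↾*↾N∩≡pairWeight : ∀ U u v → (w ↾ U) u * (w ↾ (N G u ∩ U)) v ≡ pairWeight U u v
  ↾*↾N∩≡pairWeight U u v = trans (cong (_*_ ((w ↾ U) u)) (trans (↾-∩ {f = w} (N G u) U v) (↾-N G (w ↾ U) u v)))
                         (*-if (adj G u v))
    where
    *-if : ∀ b → (w ↾ U) u * (if b then (w ↾ U) v else 0ℚ) ≡ (if b then (w ↾ U) u * (w ↾ U) v else 0ℚ)
    *-if true  = refl
    *-if false = *-zeroʳ ((w ↾ U) u)

  ↾*↾S∩N∩≡pairWeight↾S : ∀ U u v → (w ↾ U) u * (w ↾ (S ∩ (N G u ∩ U))) v ≡ (pairWeight U u ↾ S) v
  ↾*↾S∩N∩≡pairWeight↾S U u v = begin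
    (w ↾ U) u * (w ↾ (S ∩ (N G u ∩ U))) v                 ≡⟨ cong (_*_ ((w ↾ U) u)) (↾-∩ {f = w} S (N G u ∩ U) v) ⟩
    (w ↾ U) u * ((w ↾ (N G u ∩ U)) ↾ S) v                 ≡⟨ ↾-*ˡ {f = w ↾ (N G u ∩ U)} ((w ↾ U) u) S v ⟩
    ((λ v → (w ↾ U) u * (w ↾ (N G u ∩ U)) v) ↾ S) v       ≡⟨ ↾-cong S (↾*↾N∩≡pairWeight U u) v ⟩
    (pairWeight U u ↾ S) v                                ∎
    where open ≡-Reasoning

  private
    *-weight : ∀ c X → c * weight w X ≡ ∑ (λ v → c * (w ↾ X) v)
    *-weight c X = trans (cong (c *_) (weight≡∑ w X)) (sym (listSum-*ˡ c (w ↾ X) (allFin n)))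

    weightedSum≡∑ : ∀ U (k : Fin n → ℚ) → listSum (λ u → w u * k u) (elems U) ≡ ∑ (λ u → (w ↾ U) u * k u)
    weightedSum≡∑ U k = trans (listSum-filter (_∈? U) (λ u → w u * k u) (allFin n)) (listSum-cong (allFin n) (↾-*ʳ {f = w} k U))

  weighted-cost≤credit : ∀ U →
    listSum (λ u → w u * cost U u) (elems U) ≤ listSum (λ u → w u * credit U u) (elems U)
  weighted-cost≤credit U = begin
    listSum (λ u → w u * cost U u) (elems U)
      ≡⟨ weightedSum≡∑ U (cost U) ⟩
    ∑ (λ u → (w ↾ U) u * cost U u)
      ≡⟨ listSum-cong (allFin n) cost-as-∑ ⟩
    ∑ (λ u → ∑ (pairWeight U u))
      ≤⟨ ∑∑-≤-2*∑∑-cover G S-cover (pairWeight U) (pairWeight-nonneg U) (pairWeight-sym U) (pairWeight-nonedge U) ⟩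
    two * ∑ (λ u → ∑ (pairWeight U u ↾ S))
      ≡⟨ listSum-*ˡ two (λ u → ∑ (pairWeight U u ↾ S)) (allFin n) ⟨
    ∑ (λ u → two * ∑ (pairWeight U u ↾ S))
      ≡⟨ listSum-cong (allFin n) credit-as-∑ ⟨
    ∑ (λ u → (w ↾ U) u * credit U u)
      ≡⟨ weightedSum≡∑ U (credit U) ⟨
    listSum (λ u → w u * credit U u) (elems U)
      ∎
    where
    open ≤-Reasoning
    cost-as-∑ : ∀ u → (w ↾ U) u * cost U u ≡ ∑ (pairWeight U u)
    cost-as-∑ u = trans (*-weight ((w ↾ U) u) (N G u ∩ U)) (listSum-cong (allFin n) (↾*↾N∩≡pairWeight U u))
    credit-as-∑ : ∀ u → (w ↾ U) u * credit U u ≡ two * ∑ (pairWeight U u ↾ S)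
    credit-as-∑ u = trans (left-comm ((w ↾ U) u) two (weight w (S ∩ (N G u ∩ U))))
      (cong (two *_) (trans (*-weight ((w ↾ U) u) (S ∩ (N G u ∩ U)))
                            (listSum-cong (allFin n) (↾*↾S∩N∩≡pairWeight↾S U u))))
      where
      left-comm : ∀ x y z → x * (y * z) ≡ y * (x * z)
      left-comm = solve 3 (λ x y z → x :* (y :* z) := y :* (x :* z)) refl
        where open +-*-Solver

  cost≤credit-if-weightless : ∀ U → weight w U ≡ 0ℚ → ∀ u → cost U u ≤ credit U u
  cost≤credit-if-weightless U W≡0 u = begin
    cost U u                             ≤⟨ weight-mono w w≥0 (p∩q⊆q (N G u) U) ⟩
    weight w U                           ≡⟨ W≡0 ⟩
    0ℚ                                   ≤⟨ *-nonneg 0≤2 (weight-nonneg w w≥0 (S ∩ (N G u ∩ U))) ⟩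
    credit U u                           ∎
    where open ≤-Reasoning

  terminal-≤ : ∀ U C → expect ((1ℚ , C) ∷ []) (weight w) ≤ potential U C
  terminal-≤ U C = begin
    1ℚ * weight w C + 0ℚ                         ≡⟨ trans (+-identityʳ _) (*-identityˡ (weight w C)) ⟩
    weight w C                                   ≡⟨ +-identityʳ (weight w C) ⟨
    weight w C + 0ℚ                              ≤⟨ +-monoʳ-≤ (weight w C) (*-nonneg 0≤2 (weight-nonneg w w≥0 (S ∩ U))) ⟩
    potential U C                                ∎
    where open ≤-Reasoning

  runNC-expect-≤ : ∀ k U C → expect (runNC k G w U C) (weight w) ≤ potential U C
  runNC-expect-≤ zero    U C = terminal-≤ U C
  runNC-expect-≤ (suc k) U C with elems U in elems≡
  ... | []     = terminal-≤ U C
  ... | x ∷ xs = begin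
    expect (concatMap (λ u → scale (p u) (next u)) (x ∷ xs)) (weight w)
      ≡⟨ expect-concatMap (λ u → scale (p u) (next u)) (x ∷ xs) (weight w) ⟩
    listSum (λ u → expect (scale (p u) (next u)) (weight w)) (x ∷ xs)
      ≡⟨ listSum-cong (x ∷ xs) (λ u → expect-scale (p u) (next u) (weight w)) ⟩
    listSum (λ u → p u * expect (next u) (weight w)) (x ∷ xs)
      ≤⟨ listSum-mono-≤ (x ∷ xs) (λ u → *-monoˡ-≤-nonNeg (p u) {{nonNegative (selectProb-nonneg w w≥0 U u)}}
                                          (runNC-expect-≤ k ((U - u) ─ N G u) (C ∪ (N G u ∩ U)))) ⟩
    listSum (λ u → p u * Φ′ u) (x ∷ xs)
      ≡⟨ cong (listSum (λ u → p u * Φ′ u)) elems≡ ⟨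
    listSum (λ u → p u * Φ′ u) (elems U)
      ≤⟨ average-≤ (elems U) (selectProb-nonneg w w≥0 U) (selectProb-sum w w≥0 U elems≡) (potential-step U C)
                   (selectProb-mono w w≥0 U (cost≤credit-if-weightless U) (weighted-cost≤credit U)) ⟩
    potential U C
      ∎
    where
    open ≤-Reasoning
    p = selectProb w U
    next : Fin n → Dist (Subset n)
    next u = runNC k G w ((U - u) ─ N G u) (C ∪ (N G u ∩ U))
    Φ′ : Fin n → ℚ
    Φ′ u = potential ((U - u) ─ N G u) (C ∪ (N G u ∩ U))

theorem1 : ∀ {n : ℕ} (G : Graph n) (w : Fin n → ℚ) → (∀ v → 0ℚ ≤ w v) →
    (∀ (p : ℚ) (C : Subset n) → (p , C) ∈D neighborCover G w → 0ℚ < p → IsVertexCover G C)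
    × (∀ (S : Subset n) → IsVertexCover G S →
        expect (neighborCover G w) (weight w) ≤ (+ 2 / 1) * weight w S)
theorem1 {n} G w w≥0 = covers , approximates
  where
  covers : ∀ p C → (p , C) ∈D neighborCover G w → 0ℚ < p → IsVertexCover G C
  -- Every outcome listed in the distribution is a cover.
  covers p C pC∈ _ = All.lookup (runNC-covers G w n ⊤ ⊥ (∣p∣≤n ⊤) (λ _ _ _ → inj₂ (inj₂ (∈⊤ , ∈⊤)))) pC∈
  approximates : ∀ S → IsVertexCover G S → expect (neighborCover G w) (weight w) ≤ (+ 2 / 1) * weight w S
  approximates S S-cover = begin
    expect (neighborCover G w) (weight w)      ≤⟨ runNC-expect-≤ G w w≥0 S-cover n ⊤ ⊥ ⟩
    weight w ⊥ + (+ 2 / 1) * weight w (S ∩ ⊤)  ≡⟨ cong₂ (λ a b → a + (+ 2 / 1) * weight w b) (weight-⊥ w) (∩-identityʳ S) ⟩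
    0ℚ + (+ 2 / 1) * weight w S                ≡⟨ +-identityˡ _ ⟩
    (+ 2 / 1) * weight w S                     ∎
    where open ≤-Reasoning
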